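{- Let $(L,G)$ be a lattice-ordered permutation group. If $(L,G)$ is 2-interval-transitive (or even just inclusion-transitive), then every orbit of $G$ on $\bar L$ is dense in $\bar L$, and $G$ is highly $o$-transitive on each such orbit.
   Context: $L$ is a dense linearly ordered set without endpoints, $\bar L$ its Dedekind completion without endpoints, $\mathrm{Aut}(L)$ the group of order-preserving bijections (each extending uniquely to $\bar L$). $(L,G)$ with $G\le\mathrm{Aut}(L)$ is a lattice-ordered permutation group if $G$ is closed under pointwise maximum and minimum ($(f\vee g)(x)=\max\{f(x),g(x)\}$, dually). $L$-intervals: $(x,y)$ with $x<y$ (bounded), rays, $L$. $(L,G)$ is 2-interval-transitive if for all $L$-intervals $I_1<I_2$, $J_1<J_2$ some $g\in G$ has $g(I_k)\cap J_k\ne\emptyset$, $k=1,2$. It is inclusion-transitive if for any bounded $L$-intervals $I,J$ there is $g\in G$ with $g(I)\subseteq J$. $G$ is highly $o$-transitive on a $G$-invariant $M\subseteq\bar L$ if for every $n$ and all $a_1<\dots<a_n$, $b_1<\dots<b_n$ in $M$ some $g\in G$ has $g(a_i)=b_i$ for all $i$. -}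

module Defs where

open import Level using (0ℓ)
open import Function using (id; _∘_)
open import Data.Product using (Σ; ∃; _×_; _,_)
open import Data.Sum using (_⊎_)
open import Data.Fin as Fin using (Fin)
open import Relation.Binary using (Rel; IsStrictTotalOrder)
open import Relation.Binary.PropositionalEquality using (_≡_)

record DLO : Set₁ where
  field
    Carrier : Set
    _<_     : Rel Carrier 0ℓ
    isSTO   : IsStrictTotalOrder _≡_ _<_
    dense   : ∀ {x y} → x < y → ∃ λ z → x < z × z < y
    noMin   : ∀ x → ∃ λ y → y < x
    noMax   : ∀ x → ∃ λ y → x < y

  _≤_ : Rel Carrier 0ℓ
  x ≤ y = x < y ⊎ x ≡ y

module _ (L : DLO) where
  open DLO L

  -- Dedekind completion of L without endpoints (determined up to
  -- isomorphism over L): a Dedekind-complete linear order without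
  -- endpoints into which L embeds order-densely.
  record Completion : Set₁ where
    field
      M       : Set
      _<ᴹ_    : Rel M 0ℓ
      isSTOᴹ  : IsStrictTotalOrder _≡_ _<ᴹ_
      ι       : Carrier → M
      ι-mono  : ∀ {x y} → x < y → ι x <ᴹ ι y
      ι-dense : ∀ {a b} → a <ᴹ b → ∃ λ x → a <ᴹ ι x × ι x <ᴹ b
      noMinᴹ  : ∀ a → ∃ λ b → b <ᴹ a
      noMaxᴹ  : ∀ a → ∃ λ b → a <ᴹ b

    _≤ᴹ_ : Rel M 0ℓ
    a ≤ᴹ b = a <ᴹ b ⊎ a ≡ b

    UpperBound : (M → Set) → M → Set
    UpperBound P u = ∀ m → P m → m ≤ᴹ u

    IsSup : (M → Set) → M → Set
    IsSup P s = UpperBound P s × (∀ u → UpperBound P u → s ≤ᴹ u)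

    field
      complete : (P : M → Set) → ∃ P → ∃ (UpperBound P) → ∃ (IsSup P)

  IsMax : Carrier → Carrier → Carrier → Set
  IsMax a b c = (a ≤ b → c ≡ b) × (b ≤ a → c ≡ a)

  IsMin : Carrier → Carrier → Carrier → Set
  IsMin a b c = (a ≤ b → c ≡ a) × (b ≤ a → c ≡ b)

  record LPermGroup : Set₁ where
    field
      G       : (Carrier → Carrier) → Set
      G-mono  : ∀ {g x y} → G g → x < y → g x < g y
      G-surj  : ∀ {g} → G g → ∀ y → ∃ λ x → g x ≡ y
      G-id    : G id
      G-comp  : ∀ {g h} → G g → G h → G (g ∘ h)
      G-inv   : ∀ {g} → G g → ∃ λ h → G h × (∀ x → h (g x) ≡ x)
      G-join  : ∀ {f g} → G f → G g → ∃ λ h → G h × (∀ x → IsMax (f x) (g x) (h x))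
      G-meet  : ∀ {f g} → G f → G g → ∃ λ h → G h × (∀ x → IsMin (f x) (g x) (h x))

  data Interval : Set where
    bounded  : (x y : Carrier) → x < y → Interval
    leftRay  : Carrier → Interval
    rightRay : Carrier → Interval
    whole    : Interval

  _∈I_ : Carrier → Interval → Set
  z ∈I bounded x y _ = x < z × z < y
  z ∈I leftRay y     = z < y
  z ∈I rightRay x    = x < z
  z ∈I whole         = Data.Unit.⊤
    where import Data.Unit

  _<I_ : Interval → Interval → Set
  I <I J = ∀ x y → x ∈I I → y ∈I J → x < y

  Meets : (Carrier → Carrier) → Interval → Interval → Set
  Meets g I J = ∃ λ x → x ∈I I × g x ∈I J

  Maps-into : (Carrier → Carrier) → Interval → Interval → Set
  Maps-into g I J = ∀ x → x ∈I I → g x ∈I J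

  module _ (P : LPermGroup) where
    open LPermGroup P

    TwoIntervalTransitive : Set
    TwoIntervalTransitive = ∀ I₁ I₂ J₁ J₂ → I₁ <I I₂ → J₁ <I J₂ →
      ∃ λ g → G g × Meets g I₁ J₁ × Meets g I₂ J₂

    InclusionTransitive : Set
    InclusionTransitive = ∀ x y x' y' (p : x < y) (q : x' < y') →
      ∃ λ g → G g × Maps-into g (bounded x y p) (bounded x' y' q)

    module _ (𝓜 : Completion) where
      open Completion 𝓜

      -- m' = ḡ(m) for the unique extension ḡ of g to \bar L
      Ext : (Carrier → Carrier) → M → M → Set
      Ext g m m' = ∀ l → (ι l <ᴹ m → ι (g l) <ᴹ m') × (ι (g l) <ᴹ m' → ι l <ᴹ m)

      Orbit : M → M → Set
      Orbit c b = ∃ λ g → G g × Ext g c b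

      DenseIn : (M → Set) → Set
      DenseIn O = ∀ a b → a <ᴹ b → ∃ λ m → O m × a <ᴹ m × m <ᴹ b

      StrictlyIncreasing : ∀ {n} → (Fin n → M) → Set
      StrictlyIncreasing a = ∀ i j → i Fin.< j → a i <ᴹ a j

      HighlyOTransitiveOn : (M → Set) → Set
      HighlyOTransitiveOn O = ∀ n (a b : Fin n → M) →
        StrictlyIncreasing a → StrictlyIncreasing b →
        (∀ i → O (a i)) → (∀ i → O (b i)) →
        ∃ λ g → G g × (∀ i → Ext g (a i) (b i))

-- Inclusion transitivity lets G squeeze any finite subset of \bar L into any
-- bounded interval; for a single point this is density of the orbits.  High
-- o-transitivity is proved by induction on the length of the tuples a, b: if
-- g₀ maps a₀ to b₀ and g maps the remaining aᵢ to bᵢ, squeezing yields f with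
-- f(a₀) > b₀ and f(aᵢ) < bᵢ for i ≥ 1, and k with the opposite inequalities,
-- so that (g₀ ∧ f) ∨ (g ∧ k) maps every aᵢ to bᵢ.
module Submission where

open import Defs
open import Level using (0ℓ)
open import Data.Product using (_×_)
open import Data.Sum using (_⊎_)
open import Axiom.ExcludedMiddle using (ExcludedMiddle)

open import Data.Product using (∃; _,_; proj₁; proj₂)
open import Data.Sum using (inj₁; inj₂; [_,_])
open import Data.Empty using (⊥-elim)
open import Data.Fin using (Fin; zero; suc)
open import Data.Nat as ℕ using (s≤s; z≤n)
open import Function using (id; _∘_)
open import Relation.Binary using (Rel; IsStrictTotalOrder; Asymmetric; tri<; tri≈; tri>)
open import Relation.Binary.PropositionalEquality using (_≡_; refl; sym; cong; subst)
open import Relation.Nullary using (¬_)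

strictMono⇒reflects : ∀ {A B : Set} {_<₁_ : Rel A 0ℓ} {_<₂_ : Rel B 0ℓ} (f : A → B) →
  IsStrictTotalOrder _≡_ _<₁_ → Asymmetric _<₂_ →
  (∀ {x y} → x <₁ y → f x <₂ f y) → ∀ {x y} → f x <₂ f y → x <₁ y
strictMono⇒reflects f sto asym mono {x} {y} fx<fy with IsStrictTotalOrder.compare sto x y
... | tri< x<y _ _ = x<y
... | tri≈ _ refl _ = ⊥-elim (asym fx<fy fx<fy)
... | tri> _ _ y<x = ⊥-elim (asym fx<fy (mono y<x))

module _ {L : DLO} {P : LPermGroup L} where
  open DLO L
  open LPermGroup P
  private module L< = IsStrictTotalOrder isSTO

  twoIntervalTransitive⇒inclusionTransitive :
    TwoIntervalTransitive L P → InclusionTransitive L P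
  twoIntervalTransitive⇒inclusionTransitive 2it x y x' y' x<y x'<y' with dense x'<y'
  ... | s , x'<s , s<y'
    with 2it (leftRay x) (rightRay y) (bounded x' s x'<s) (bounded s y' s<y')
             (λ _ _ a<x y<b → L<.trans a<x (L<.trans x<y y<b))
             (λ _ _ (_ , a<s) (s<b , _) → L<.trans a<s s<b)
  ... | g , Gg , (a , a<x , x'<ga , _) , (b , y<b , _ , gb<y') =
    g , Gg , λ z (x<z , z<y) → L<.trans x'<ga (G-mono Gg (L<.trans a<x x<z))
                             , L<.trans (G-mono Gg (L<.trans z<y y<b)) gb<y'

module OrbitsOnCompletion (L : DLO) (𝓜 : Completion L) (P : LPermGroup L) where
  open DLO L
  open Completion 𝓜
  open LPermGroup P
  private
    module L< = IsStrictTotalOrder isSTO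
    module M< = IsStrictTotalOrder isSTOᴹ
  open import Relation.Binary.Construct.StrictToNonStrict _≡_ _<ᴹ_ using (<-≤-trans; ≤-<-trans)

  <-≤ᴹ-trans : ∀ {a b c} → a <ᴹ b → b ≤ᴹ c → a <ᴹ c
  <-≤ᴹ-trans = <-≤-trans M<.trans M<.<-respʳ-≈

  ≤-<ᴹ-trans : ∀ {a b c} → a ≤ᴹ b → b <ᴹ c → a <ᴹ c
  ≤-<ᴹ-trans = ≤-<-trans sym M<.trans M<.<-respˡ-≈

  ≤ᴹ⇒≯ : ∀ {a b} → a ≤ᴹ b → ¬ b <ᴹ a
  ≤ᴹ⇒≯ a≤b b<a = M<.irrefl refl (≤-<ᴹ-trans a≤b b<a)

  ≮ᴹ⇒≥ : ∀ {a b} → ¬ b <ᴹ a → a ≤ᴹ b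
  ≮ᴹ⇒≥ {a} {b} b≮a with M<.compare a b
  ... | tri< a<b _ _ = inj₁ a<b
  ... | tri≈ _ a≡b _ = inj₂ a≡b
  ... | tri> _ _ b<a = ⊥-elim (b≮a b<a)

  ι-reflects : ∀ {x y} → ι x <ᴹ ι y → x < y
  ι-reflects = strictMono⇒reflects {_<₂_ = _<ᴹ_} ι isSTO M<.asym ι-mono

  G-reflects : ∀ {g} → G g → ∀ {x y} → g x < g y → x < y
  G-reflects {g} Gg = strictMono⇒reflects {_<₂_ = _<_} g isSTO L<.asym (G-mono Gg)

  ι∘-mono : ∀ {g} → G g → ∀ {x y} → ι x <ᴹ ι y → ι (g x) <ᴹ ι (g y)
  ι∘-mono Gg = ι-mono ∘ G-mono Gg ∘ ι-reflects

  ι-between : ∀ {a b} → a <ᴹ b → ∃ λ x → ∃ λ y → a <ᴹ ι x × x < y × ι y <ᴹ b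
  ι-between a<b with ι-dense a<b
  ... | x , a<x , x<b with ι-dense x<b
  ... | y , x<y , y<b = x , y , a<x , ι-reflects x<y , y<b

  ι-above : ∀ m → ∃ λ v → m <ᴹ ι v
  ι-above m with noMaxᴹ m
  ... | _ , m<m' with ι-dense m<m'
  ... | v , m<v , _ = v , m<v

  ι-below : ∀ m → ∃ λ u → ι u <ᴹ m
  ι-below m with noMinᴹ m
  ... | _ , m'<m with ι-dense m'<m
  ... | u , _ , u<m = u , u<m

  ι-above₂ : ∀ m m' → ∃ λ v → m <ᴹ ι v × m' <ᴹ ι v
  ι-above₂ m m' with M<.compare m m'
  ... | tri< m<m' _ _ = let (v , m'<v) = ι-above m' in v , M<.trans m<m' m'<v , m'<v
  ... | tri≈ _ refl _ = let (v , m<v) = ι-above m in v , m<v , m<v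
  ... | tri> _ _ m'<m = let (v , m<v) = ι-above m in v , m<v , M<.trans m'<m m<v

  ι-below₂ : ∀ m m' → ∃ λ u → ι u <ᴹ m × ι u <ᴹ m'
  ι-below₂ m m' with M<.compare m m'
  ... | tri< m<m' _ _ = let (u , u<m) = ι-below m in u , u<m , M<.trans u<m m<m'
  ... | tri≈ _ refl _ = let (u , u<m) = ι-below m in u , u<m , u<m
  ... | tri> _ _ m'<m = let (u , u<m') = ι-below m' in u , M<.trans u<m' m'<m , u<m'

  ι-upperBound : ∀ m {n} (a : Fin n → M) → ∃ λ v → m <ᴹ ι v × (∀ i → a i <ᴹ ι v)
  ι-upperBound m {ℕ.zero} a = let (v , m<v) = ι-above m in v , m<v , λ ()
  ι-upperBound m {ℕ.suc n} a with ι-upperBound m (a ∘ suc)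
  ... | v , m<v , tail<v with ι-above₂ (ι v) (a zero)
  ... | w , v<w , a₀<w = w , M<.trans m<v v<w , λ { zero → a₀<w ; (suc i) → M<.trans (tail<v i) v<w }

  ι-lowerBound : ∀ m {n} (a : Fin n → M) → ∃ λ u → ι u <ᴹ m × (∀ i → ι u <ᴹ a i)
  ι-lowerBound m {ℕ.zero} a = let (u , u<m) = ι-below m in u , u<m , λ ()
  ι-lowerBound m {ℕ.suc n} a with ι-lowerBound m (a ∘ suc)
  ... | u , u<m , u<tail with ι-below₂ (ι u) (a zero)
  ... | w , w<u , w<a₀ = w , M<.trans w<u u<m , λ { zero → w<a₀ ; (suc i) → M<.trans w<u (u<tail i) }

  infix 4 _↦[_]_ _↦[_]<_ _↦[_]>_

  _↦[_]_ : M → (Carrier → Carrier) → M → Set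
  m ↦[ g ] m' = Ext L P 𝓜 g m m'

  _↦[_]<_ : M → (Carrier → Carrier) → M → Set
  m ↦[ g ]< b = ∃ λ r → m ↦[ g ] r × r <ᴹ b

  _↦[_]>_ : M → (Carrier → Carrier) → M → Set
  m ↦[ g ]> b = ∃ λ r → m ↦[ g ] r × b <ᴹ r

  ι-↦ : ∀ {g} → G g → ∀ x → ι x ↦[ g ] ι (g x)
  ι-↦ Gg x l = ι∘-mono Gg , ι-mono ∘ G-reflects Gg ∘ ι-reflects

  ↦-mono : ∀ {g m₁ m₂ r₁ r₂} → G g → m₁ <ᴹ m₂ → m₁ ↦[ g ] r₁ → m₂ ↦[ g ] r₂ → r₁ <ᴹ r₂
  ↦-mono Gg m₁<m₂ e₁ e₂ with ι-dense m₁<m₂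
  ... | l , m₁<l , l<m₂ =
    ≤-<ᴹ-trans (≮ᴹ⇒≥ (λ gl<r₁ → M<.asym m₁<l (proj₂ (e₁ l) gl<r₁))) (proj₁ (e₂ l) l<m₂)

  -- The extension of g is the supremum of g over the points of L below m.
  ↦-total : ∀ {g} → G g → ∀ m → ∃ (m ↦[ g ]_)
  ↦-total {g} Gg m = s , λ l → forward l , backward l
    where
    S : M → Set
    S r = ∃ λ l → ι l <ᴹ m × r ≡ ι (g l)

    inhabited : ∃ S
    inhabited = let (l , l<m) = ι-below m in ι (g l) , l , l<m , refl

    upper : ∀ {l} → m ≤ᴹ ι l → UpperBound S (ι (g l))
    upper m≤l _ (_ , l'<m , refl) = inj₁ (ι∘-mono Gg (<-≤ᴹ-trans l'<m m≤l))

    bounded-above : ∃ (UpperBound S)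
    bounded-above = let (v , m<v) = ι-above m in ι (g v) , upper (inj₁ m<v)

    sup : ∃ (IsSup S)
    sup = complete S inhabited bounded-above

    s : M
    s = proj₁ sup

    s-upper : UpperBound S s
    s-upper = proj₁ (proj₂ sup)

    s-least : ∀ u → UpperBound S u → s ≤ᴹ u
    s-least = proj₂ (proj₂ sup)

    forward : ∀ l → ι l <ᴹ m → ι (g l) <ᴹ s
    forward l l<m with ι-dense l<m
    ... | l' , l<l' , l'<m = <-≤ᴹ-trans (ι∘-mono Gg l<l') (s-upper _ (l' , l'<m , refl))

    backward : ∀ l → ι (g l) <ᴹ s → ι l <ᴹ m
    backward l gl<s with M<.compare (ι l) m
    ... | tri< l<m _ _ = l<m
    ... | tri≈ _ l≡m _ = ⊥-elim (≤ᴹ⇒≯ (s-least _ (upper (inj₂ (sym l≡m)))) gl<s)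
    ... | tri> _ _ m<l = ⊥-elim (≤ᴹ⇒≯ (s-least _ (upper (inj₁ m<l))) gl<s)

  ↦-∘ : ∀ {f g m m' m''} → m ↦[ f ] m' → m' ↦[ g ] m'' → m ↦[ g ∘ f ] m''
  ↦-∘ e₁ e₂ l = proj₁ (e₂ _) ∘ proj₁ (e₁ l) , proj₂ (e₁ l) ∘ proj₂ (e₂ _)

  ↦-inverse : ∀ {f k m m'} → G f → (∀ x → k (f x) ≡ x) → m ↦[ f ] m' → m' ↦[ k ] m
  ↦-inverse {f} {k} {m} {m'} Gf k∘f≡id e l =
    (λ l<m' → proj₂ (e (k l)) (subst (λ z → ι z <ᴹ m') (sym f∘k≡id) l<m')) ,
    (λ kl<m → subst (λ z → ι z <ᴹ m') f∘k≡id (proj₁ (e (k l)) kl<m))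
    where
    f∘k≡id : f (k l) ≡ l
    f∘k≡id with G-surj Gf l
    ... | x , refl = cong f (k∘f≡id x)

  ↦>-inverse : ∀ {f k a b} → G f → G k → (∀ x → k (f x) ≡ x) → b ↦[ f ]> a → a ↦[ k ]< b
  ↦>-inverse Gf Gk k∘f≡id (r , e , a<r) =
    let (s , e') = ↦-total Gk _ in s , e' , ↦-mono Gk a<r e' (↦-inverse Gf k∘f≡id e)

  ↦<-inverse : ∀ {f k a b} → G f → G k → (∀ x → k (f x) ≡ x) → b ↦[ f ]< a → a ↦[ k ]> b
  ↦<-inverse Gf Gk k∘f≡id (r , e , r<a) =
    let (s , e') = ↦-total Gk _ in s , e' , ↦-mono Gk r<a (↦-inverse Gf k∘f≡id e) e'

  ↦-into : ∀ {f u v x y m r} → G f → (∀ l → u < l × l < v → x < f l × f l < y) →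
           ι u <ᴹ m → m <ᴹ ι v → m ↦[ f ] r → ι x <ᴹ r × r <ᴹ ι y
  ↦-into Gf f-into u<m m<v e with ι-dense u<m | ι-dense m<v
  ... | l , u<l , l<m | l' , m<l' , l'<v =
    M<.trans (ι-mono (proj₁ (f-into l (ι-reflects u<l , ι-reflects (M<.trans l<m m<v)))))
             (proj₁ (e l) l<m) ,
    M<.trans (↦-mono Gf m<l' e (ι-↦ Gf l'))
             (ι-mono (proj₂ (f-into l' (ι-reflects (M<.trans u<m m<l') , ι-reflects l'<v))))

  PointwiseMin PointwiseMax : (f g h : Carrier → Carrier) → Set
  PointwiseMin f g h = ∀ x → IsMin L (f x) (g x) (h x)
  PointwiseMax f g h = ∀ x → IsMax L (f x) (g x) (h x)

  PointwiseMin-comm : ∀ {f g h} → PointwiseMin f g h → PointwiseMin g f h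
  PointwiseMin-comm min x = proj₂ (min x) , proj₁ (min x)

  PointwiseMax-comm : ∀ {f g h} → PointwiseMax f g h → PointwiseMax g f h
  PointwiseMax-comm max x = proj₂ (max x) , proj₁ (max x)

  IsMin-cases : ∀ {a b c} → IsMin L a b c → c ≡ a ⊎ (c ≡ b × b < a)
  IsMin-cases {a} {b} (a≤b⇒ , b≤a⇒) with L<.compare a b
  ... | tri< a<b _ _ = inj₁ (a≤b⇒ (inj₁ a<b))
  ... | tri≈ _ a≡b _ = inj₁ (a≤b⇒ (inj₂ a≡b))
  ... | tri> _ _ b<a = inj₂ (b≤a⇒ (inj₁ b<a) , b<a)

  IsMax-cases : ∀ {a b c} → IsMax L a b c → c ≡ a ⊎ (c ≡ b × a < b)
  IsMax-cases {a} {b} (a≤b⇒ , b≤a⇒) with L<.compare a b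
  ... | tri< a<b _ _ = inj₂ (a≤b⇒ (inj₁ a<b) , a<b)
  ... | tri≈ _ a≡b _ = inj₁ (b≤a⇒ (inj₂ (sym a≡b)))
  ... | tri> _ _ b<a = inj₁ (b≤a⇒ (inj₁ b<a))

  ↦-meet : ∀ {f g h m b r} → PointwiseMin f g h →
           m ↦[ f ] b → m ↦[ g ] r → b ≤ᴹ r → m ↦[ h ] b
  ↦-meet min ef eg b≤r l with IsMin-cases (min l)
  ... | inj₁ hl≡fl rewrite hl≡fl = ef l
  ... | inj₂ (hl≡gl , gl<fl) rewrite hl≡gl =
    M<.trans (ι-mono gl<fl) ∘ proj₁ (ef l) , proj₂ (eg l) ∘ (λ gl<b → <-≤ᴹ-trans gl<b b≤r)

  ↦<-meet : ∀ {f g h m b} → PointwiseMin f g h → G f → m ↦[ g ]< b → m ↦[ h ]< b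
  ↦<-meet min Gf (q , eg , q<b) with ↦-total Gf _
  ... | p , ef with M<.compare q p
  ... | tri< q<p _ _ = q , ↦-meet (PointwiseMin-comm min) eg ef (inj₁ q<p) , q<b
  ... | tri≈ _ q≡p _ = p , ↦-meet min ef eg (inj₂ (sym q≡p)) , subst (_<ᴹ _) q≡p q<b
  ... | tri> _ _ p<q = p , ↦-meet min ef eg (inj₁ p<q) , M<.trans p<q q<b

  ↦-join : ∀ {f g h m b} → PointwiseMax f g h → m ↦[ f ] b → m ↦[ g ]< b → m ↦[ h ] b
  ↦-join max ef (r , eg , r<b) l with IsMax-cases (max l)
  ... | inj₁ hl≡fl rewrite hl≡fl = ef l
  ... | inj₂ (hl≡gl , fl<gl) rewrite hl≡gl =
    (λ l<m → M<.trans (proj₁ (eg l) l<m) r<b) , proj₂ (ef l) ∘ M<.trans (ι-mono fl<gl)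

  squeeze : InclusionTransitive L P → ∀ {x y} → x < y → ∀ {n} (a : Fin n → M) →
            ∃ λ f → G f × (∀ i → ∃ λ r → a i ↦[ f ] r × ι x <ᴹ r × r <ᴹ ι y)
  squeeze it {x} {y} x<y a with ι-lowerBound (ι x) a | ι-upperBound (ι x) a
  ... | u , u<x , u<a | v , x<v , a<v with it u v x y (ι-reflects (M<.trans u<x x<v)) x<y
  ... | f , Gf , f-into =
    f , Gf , λ i → let (r , e) = ↦-total Gf (a i) in r , e , ↦-into Gf f-into (u<a i) (a<v i) e

  Increasing : ∀ {n} → (Fin n → M) → Set
  Increasing = StrictlyIncreasing L P 𝓜

  Increasing-tail : ∀ {n} {a : Fin (ℕ.suc n) → M} → Increasing a → Increasing (a ∘ suc)
  Increasing-tail a↑ i j i<j = a↑ (suc i) (suc j) (s≤s i<j)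

  Increasing-second≤ : ∀ {n} {a : Fin (ℕ.suc (ℕ.suc n)) → M} → Increasing a →
                       ∀ i → a (suc zero) ≤ᴹ a (suc i)
  Increasing-second≤ a↑ zero = inj₂ refl
  Increasing-second≤ a↑ (suc i) = inj₁ (a↑ (suc zero) (suc (suc i)) (s≤s (s≤s z≤n)))

  separate : InclusionTransitive L P → ∀ {n} (a b : Fin (ℕ.suc (ℕ.suc n)) → M) →
             Increasing b →
             ∃ λ f → G f × a zero ↦[ f ]> b zero × (∀ i → a (suc i) ↦[ f ]< b (suc i))
  separate it a b b↑ with ι-between (b↑ zero (suc zero) (s≤s z≤n))
  ... | x , y , b₀<x , x<y , y<b₁ with squeeze it x<y a
  ... | f , Gf , into = f , Gf , above , below
    where
    above : a zero ↦[ f ]> b zero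
    above = let (r , e , x<r , _) = into zero in r , e , M<.trans b₀<x x<r

    below : ∀ i → a (suc i) ↦[ f ]< b (suc i)
    below i = let (r , e , _ , r<y) = into (suc i) in
      r , e , M<.trans r<y (<-≤ᴹ-trans y<b₁ (Increasing-second≤ b↑ i))

  extend-tuple : InclusionTransitive L P → ∀ {n} (a b : Fin (ℕ.suc (ℕ.suc n)) → M) →
                 Increasing a → Increasing b →
                 ∀ {g₀} → G g₀ → a zero ↦[ g₀ ] b zero →
                 ∀ {g} → G g → (∀ i → a (suc i) ↦[ g ] b (suc i)) →
                 ∃ λ h → G h × (∀ i → a i ↦[ h ] b i)
  extend-tuple it a b a↑ b↑ Gg₀ e₀ Gg e with separate it a b b↑ | separate it b a a↑
  ... | f , Gf , f₀ , fₛ | f' , Gf' , f'₀ , f'ₛ with G-inv Gf'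
  ... | k , Gk , k∘f'≡id with G-meet Gg₀ Gf | G-meet Gg Gk
  ... | p , Gp , p-min | q , Gq , q-min with G-join Gp Gq
  ... | h , Gh , h-max = h , Gh , λ { zero → ↦-join h-max p₀ q₀
                                    ; (suc i) → ↦-join (PointwiseMax-comm h-max) (qₛ i) (pₛ i) }
    where
    p₀ : a zero ↦[ p ] b zero
    p₀ = let (r , ef , b₀<r) = f₀ in ↦-meet p-min e₀ ef (inj₁ b₀<r)

    pₛ : ∀ i → a (suc i) ↦[ p ]< b (suc i)
    pₛ i = ↦<-meet p-min Gg₀ (fₛ i)

    q₀ : a zero ↦[ q ]< b zero
    q₀ = ↦<-meet q-min Gg (↦>-inverse Gf' Gk k∘f'≡id f'₀)

    qₛ : ∀ i → a (suc i) ↦[ q ] b (suc i)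
    qₛ i = let (r , ek , b<r) = ↦<-inverse Gf' Gk k∘f'≡id (f'ₛ i) in ↦-meet q-min (e i) ek (inj₁ b<r)

  orbit-↦ : ∀ {c a b} → Orbit L P 𝓜 c a → Orbit L P 𝓜 c b → ∃ λ g → G g × a ↦[ g ] b
  orbit-↦ (α , Gα , c↦a) (β , Gβ , c↦b) with G-inv Gα
  ... | α⁻¹ , Gα⁻¹ , α⁻¹∘α≡id = β ∘ α⁻¹ , G-comp Gβ Gα⁻¹ , ↦-∘ (↦-inverse Gα α⁻¹∘α≡id c↦a) c↦b

  orbit-dense : InclusionTransitive L P → ∀ c → DenseIn L P 𝓜 (Orbit L P 𝓜 c)
  orbit-dense it c a b a<b with ι-between a<b
  ... | x , y , a<x , x<y , y<b with squeeze it x<y {1} (λ _ → c)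
  ... | f , Gf , into = let (r , e , x<r , r<y) = into zero in
    r , (f , Gf , e) , M<.trans a<x x<r , M<.trans r<y y<b

  orbit-highlyTransitive : InclusionTransitive L P → ∀ c → HighlyOTransitiveOn L P 𝓜 (Orbit L P 𝓜 c)
  orbit-highlyTransitive it c ℕ.zero a b _ _ _ _ = id , G-id , λ ()
  orbit-highlyTransitive it c (ℕ.suc ℕ.zero) a b _ _ a∈O b∈O =
    let (g , Gg , e) = orbit-↦ (a∈O zero) (b∈O zero) in g , Gg , λ { zero → e }
  orbit-highlyTransitive it c (ℕ.suc (ℕ.suc n)) a b a↑ b↑ a∈O b∈O =
    let (g₀ , Gg₀ , e₀) = orbit-↦ (a∈O zero) (b∈O zero)
        (g , Gg , e) = orbit-highlyTransitive it c (ℕ.suc n) (a ∘ suc) (b ∘ suc)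
                         (Increasing-tail a↑) (Increasing-tail b↑) (a∈O ∘ suc) (b∈O ∘ suc)
    in extend-tuple it a b a↑ b↑ Gg₀ e₀ Gg e

proposition11p1 : ExcludedMiddle 0ℓ →
    (L : DLO) (𝓜 : Completion L) (P : LPermGroup L) →
    TwoIntervalTransitive L P ⊎ InclusionTransitive L P →
    ∀ c → DenseIn L P 𝓜 (Orbit L P 𝓜 c) × HighlyOTransitiveOn L P 𝓜 (Orbit L P 𝓜 c)
proposition11p1 _ L 𝓜 P transitive c = orbit-dense it c , orbit-highlyTransitive it c
  where
  open OrbitsOnCompletion L 𝓜 P
  it : InclusionTransitive L P
  it = [ twoIntervalTransitive⇒inclusionTransitive {L} {P} , id ] transitive
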